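{- Let $G$ be a graph with $\lambda(G)=1$, and let $e=uv$ be an edge such that deleting $e$ disconnects $G$ into $G_1$ and $G_2$. Then $\mathrm{sn}(G)=\max(\mathrm{sn}(G_1),\mathrm{sn}(G_2))$.
   Context: Graphs are finite, multiple edges allowed, no loops; $\lambda$ is edge-connectivity. A scramble is a finite collection of nonempty vertex sets (eggs) each inducing a connected subgraph; its order is $\min(h,e)$ where $h$ is the minimum size of a vertex set meeting every egg and $e$ is the minimum of $|E(A,A^C)|$ (number of edges between $A$ and $A^C$) over all $A\subseteq V$ such that some egg is contained in $A$ and some egg in $A^C$ ($+\infty$ if none). The scramble number $\mathrm{sn}$ is the maximum order of a scramble. -}

module Defs where

open import Data.Nat using (ℕ; _≤_)
open import Data.Bool using (Bool; true; false; not; _∧_; _xor_)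
open import Data.Fin using (Fin; zero; suc)
open import Data.List using (List; []; _∷_; length; lookup; removeAt; filterᵇ)
open import Data.List.Relation.Unary.All using (All; []; _∷_)
open import Data.List.Relation.Unary.Any using (Any)
open import Data.List.Membership.Propositional using (_∈_)
open import Data.Product using (Σ; ∃; _×_; _,_; proj₁; proj₂)
open import Data.Sum using (_⊎_)
open import Relation.Binary.PropositionalEquality using (_≡_; _≢_)

-- A finite loopless multigraph on vertex set Fin n; edges are an (unordered
-- meaning) list of endpoint pairs, repetitions allowed (multiple edges).
record Graph : Set where
  field
    n        : ℕ
    edges    : List (Fin n × Fin n)
    loopless : All (λ e → proj₁ e ≢ proj₂ e) edges
open Graph public

VSet : Graph → Set
VSet G = Fin (n G) → Bool

full : (G : Graph) → VSet G
full G _ = true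

compl : {G : Graph} → VSet G → VSet G
compl S v = not (S v)

_⊆_ : {G : Graph} → VSet G → VSet G → Set
_⊆_ {G} S U = (v : Fin (n G)) → S v ≡ true → U v ≡ true

Nonempty : {G : Graph} → VSet G → Set
Nonempty {G} S = Σ (Fin (n G)) λ v → S v ≡ true

All-removeAt : {A : Set} {P : A → Set} (xs : List A) (i : Fin (length xs)) →
               All P xs → All P (removeAt xs i)
All-removeAt (x ∷ xs) zero (_ ∷ ps) = ps
All-removeAt (x ∷ xs) (suc i) (p ∷ ps) = p ∷ All-removeAt xs i ps

_─_ : (G : Graph) → Fin (length (edges G)) → Graph
G ─ i = record { n = n G ; edges = removeAt (edges G) i
               ; loopless = All-removeAt (edges G) i (loopless G) }

-- walks of G staying inside the vertex set S (i.e. walks in G[S])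
data Walk (G : Graph) (S : VSet G) : Fin (n G) → Fin (n G) → Set where
  stay : ∀ {x} → S x ≡ true → Walk G S x x
  step : ∀ {x y z} → S x ≡ true → ((x , y) ∈ edges G ⊎ (y , x) ∈ edges G) →
         Walk G S y z → Walk G S x z

Connected : (G : Graph) → VSet G → Set
Connected G S = ∀ x y → S x ≡ true → S y ≡ true → Walk G S x y

-- number of edges of G[U] between A and U ∖ A, i.e. |E(A, A^C)| in G[U]
cutSize : (G : Graph) → VSet G → VSet G → ℕ
cutSize G U A =
  length (filterᵇ (λ e → U (proj₁ e) ∧ U (proj₂ e) ∧ (A (proj₁ e) xor A (proj₂ e)))
                  (edges G))

EdgeConnectivity : (G : Graph) → ℕ → Set
EdgeConnectivity G k =
  ((A : VSet G) → Nonempty {G} A → Nonempty {G} (compl {G} A) → k ≤ cutSize G (full G) A)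
  × Σ (VSet G) (λ A → Nonempty {G} A × Nonempty {G} (compl {G} A) × cutSize G (full G) A ≡ k)

IsScramble : (G : Graph) → VSet G → List (VSet G) → Set
IsScramble G U eggs = All (λ E → (_⊆_ {G} E U) × Nonempty {G} E × Connected G E) eggs

Hitting : (G : Graph) → VSet G → List (VSet G) → List (Fin (n G)) → Set
Hitting G U eggs L = All (λ v → U v ≡ true) L × All (λ E → Any (λ v → E v ≡ true) L) eggs

Separates : (G : Graph) → VSet G → List (VSet G) → VSet G → Set
Separates G U eggs A =
  (_⊆_ {G} A U) × Any (λ E → _⊆_ {G} E A) eggs × Any (λ E → _⊆_ {G} E (λ v → U v ∧ not (A v))) eggs

-- order(S) ≥ k, i.e. h ≥ k and e ≥ k  (order = min(h,e))
OrderAtLeast : (G : Graph) → VSet G → List (VSet G) → ℕ → Set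
OrderAtLeast G U eggs k =
  ((L : List (Fin (n G))) → Hitting G U eggs L → k ≤ length L)
  × ((A : VSet G) → Separates G U eggs A → k ≤ cutSize G U A)

ScrambleNumber : (G : Graph) → VSet G → ℕ → Set
ScrambleNumber G U k =
  Σ (List (VSet G)) (λ eggs → IsScramble G U eggs × OrderAtLeast G U eggs k)
  × ((eggs : List (VSet G)) (m : ℕ) → IsScramble G U eggs → OrderAtLeast G U eggs m → m ≤ k)

-- A scramble of one side G[P] is, after adding the bridge back, a scramble of G of at least
-- the same order: a hitting set of G can be intersected with P, and a cut of G restricts to a cut of
-- G[P] with no more edges.  Conversely, take a scramble of G.  If every egg meets P, intersect
-- the eggs with P: they stay connected, since a walk that leaves P through the bridge must
-- return through it, and a cut A of G[P] extends to a cut of G with no more edges by putting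
-- the other side entirely on the side of the bridge endpoint in P.  Otherwise some egg lies
-- inside each side, and the bridge alone separates them, so the order is at most 1 ≤ sn(G₁).
module Submission where

open import Defs
open import Data.Bool using (Bool; true; false; not; _∧_; _xor_; if_then_else_; T?)
open import Data.Bool.Properties using (∧-conicalˡ; ∧-conicalʳ; not-injective; xor-same; T-≡)
  renaming (_≟_ to _≟ᵇ_)
open import Data.Empty using (⊥-elim)
open import Data.Fin using (Fin; zero; suc)
open import Data.Fin.Properties using (any?)
open import Data.List using (List; []; _∷_; length; lookup; removeAt; filterᵇ; map)
open import Data.List.Properties using (length-filter)
open import Data.List.Membership.Propositional using (_∈_)
open import Data.List.Relation.Unary.All as All using (All; []; _∷_; all?)
open import Data.List.Relation.Unary.All.Properties using (all-filter; map⁺; map⁻)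
open import Data.List.Relation.Unary.All.Properties.Core using (¬All⇒Any¬)
open import Data.List.Relation.Unary.Any as Any using (Any; here; there)
open import Data.List.Relation.Unary.Any.Properties using (filter⁺; lookup-result)
  renaming (map⁻ to Any-map⁻)
open import Data.Nat using (ℕ; suc; _≤_; _⊔_; z≤n; s≤s)
open import Data.Nat.Properties
  using (≤-refl; ≤-trans; n≤1+n; m≤n⇒m≤1+n; ⊔-sel; m≤n⇒m≤n⊔o; m≤n⇒m≤o⊔n)
open import Data.Product using (Σ; _×_; _,_; proj₁; proj₂)
open import Data.Sum using (_⊎_; inj₁; inj₂)
import Data.Sum as Sum
open import Function using (_∘_)
open import Function.Bundles using (Equivalence)
open import Relation.Nullary using (¬_; Dec; yes; no)
open import Relation.Binary.PropositionalEquality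

clash : ∀ {b : Bool} {A : Set} → b ≡ true → b ≡ false → A
clash refl ()

xor≡false⇒≡ : ∀ a b → a xor b ≡ false → a ≡ b
xor≡false⇒≡ true true _ = refl
xor≡false⇒≡ false false _ = refl

count : {A : Set} → (A → Bool) → List A → ℕ
count p xs = length (filterᵇ p xs)

module _ {A : Set} where

  Any-with-All : {P Q : A → Set} {xs : List A} → All P xs → Any Q xs → Any (λ x → P x × Q x) xs
  Any-with-All (px ∷ _) (here qx) = here (px , qx)
  Any-with-All (_ ∷ pxs) (there qxs) = there (Any-with-All pxs qxs)

  ∈-removeAt⁻ : ∀ {x} (xs : List A) (i : Fin (length xs)) → x ∈ removeAt xs i → x ∈ xs
  ∈-removeAt⁻ (_ ∷ _) zero x∈ = there x∈
  ∈-removeAt⁻ (_ ∷ _) (suc i) (here x≡y) = here x≡y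
  ∈-removeAt⁻ (_ ∷ ys) (suc i) (there x∈) = there (∈-removeAt⁻ ys i x∈)

  ∈-removeAt-split : ∀ {x} (xs : List A) (i : Fin (length xs)) →
                     x ∈ xs → x ≡ lookup xs i ⊎ x ∈ removeAt xs i
  ∈-removeAt-split (_ ∷ _) zero (here x≡y) = inj₁ x≡y
  ∈-removeAt-split (_ ∷ _) zero (there x∈) = inj₂ x∈
  ∈-removeAt-split (_ ∷ _) (suc i) (here x≡y) = inj₂ (here x≡y)
  ∈-removeAt-split (_ ∷ ys) (suc i) (there x∈) with ∈-removeAt-split ys i x∈
  ... | inj₁ x≡ = inj₁ x≡
  ... | inj₂ x∈′ = inj₂ (there x∈′)

  filterᵇ-hits : (p E : A → Bool) → (∀ v → E v ≡ true → p v ≡ true) → {L : List A} →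
                 Any (λ v → E v ≡ true) L → Any (λ v → E v ≡ true) (filterᵇ p L)
  filterᵇ-hits p E E⊆p hit with filter⁺ (T? ∘ p) hit
  ... | inj₁ hit′ = hit′
  ... | inj₂ ¬p = ⊥-elim (¬p (Equivalence.from T-≡ (E⊆p _ (lookup-result hit))))

  module _ (p : A → Bool) where

    count-mono : (q : A → Bool) (xs : List A) →
                 All (λ x → p x ≡ true → q x ≡ true) xs → count p xs ≤ count q xs
    count-mono q [] [] = z≤n
    count-mono q (x ∷ xs) (p⇒q ∷ rest) with p x | q x
    ... | true  | true  = s≤s (count-mono q xs rest)
    ... | true  | false with () ← p⇒q refl
    ... | false | true  = m≤n⇒m≤1+n (count-mono q xs rest)
    ... | false | false = count-mono q xs rest

    count≡0⇒none : (xs : List A) → count p xs ≡ 0 → All (λ x → p x ≡ false) xs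
    count≡0⇒none [] _ = []
    count≡0⇒none (x ∷ xs) c≡0 with p x in px
    ... | false = px ∷ count≡0⇒none xs c≡0

    count-removeAt-≤ : (xs : List A) (i : Fin (length xs)) → count p (removeAt xs i) ≤ count p xs
    count-removeAt-≤ (x ∷ _) zero with p x
    ... | true  = n≤1+n _
    ... | false = ≤-refl
    count-removeAt-≤ (x ∷ xs) (suc i) with p x
    ... | true  = s≤s (count-removeAt-≤ xs i)
    ... | false = count-removeAt-≤ xs i

    count-≤-suc-removeAt : (xs : List A) (i : Fin (length xs)) →
                           count p xs ≤ suc (count p (removeAt xs i))
    count-≤-suc-removeAt (x ∷ _) zero with p x
    ... | true  = ≤-refl
    ... | false = n≤1+n _
    count-≤-suc-removeAt (x ∷ xs) (suc i) with p x
    ... | true  = s≤s (count-≤-suc-removeAt xs i)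
    ... | false = count-≤-suc-removeAt xs i

    count-removeAt-rejected : (xs : List A) (i : Fin (length xs)) → p (lookup xs i) ≡ false →
                              count p xs ≤ count p (removeAt xs i)
    count-removeAt-rejected (x ∷ _) zero px with p x
    ... | false = ≤-refl
    count-removeAt-rejected (x ∷ xs) (suc i) px with p x
    ... | true  = s≤s (count-removeAt-rejected xs i px)
    ... | false = count-removeAt-rejected xs i px

Adj : (G : Graph) → Fin (n G) → Fin (n G) → Set
Adj G x y = (x , y) ∈ edges G ⊎ (y , x) ∈ edges G

_∩_ : {m : ℕ} → (Fin m → Bool) → (Fin m → Bool) → Fin m → Bool
(P ∩ E) x = P x ∧ E x

Meets : {m : ℕ} → (Fin m → Bool) → (Fin m → Bool) → Set
Meets {m} P E = Σ (Fin m) λ x → (P ∩ E) x ≡ true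

meets? : {m : ℕ} (P E : Fin m → Bool) → Dec (Meets P E)
meets? P E = any? (λ x → (P ∩ E) x ≟ᵇ true)

avoids⇒outside : {m : ℕ} (P E : Fin m → Bool) → ¬ Meets P E → ∀ w → E w ≡ true → P w ≡ false
avoids⇒outside P E avoids w Ew with P w in Pw
... | true  = ⊥-elim (avoids (w , cong₂ _∧_ Pw Ew))
... | false = refl

crosses : {m : ℕ} → (Fin m → Bool) → (Fin m → Bool) → Fin m × Fin m → Bool
crosses U A e = U (proj₁ e) ∧ U (proj₂ e) ∧ (A (proj₁ e) xor A (proj₂ e))

HasScrambleOfOrder : (G : Graph) → VSet G → ℕ → Set
HasScrambleOfOrder G U k = Σ (List (VSet G)) λ eggs → IsScramble G U eggs × OrderAtLeast G U eggs k

order≤scrambleNumber : {G : Graph} {U : VSet G} {k m : ℕ} →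
                       ScrambleNumber G U k → HasScrambleOfOrder G U m → m ≤ k
order≤scrambleNumber (_ , maximal) (eggs , scramble , order) = maximal eggs _ scramble order

HasScrambleOfOrder-⊔ : {G : Graph} {U : VSet G} {k₁ k₂ : ℕ} →
                       HasScrambleOfOrder G U k₁ → HasScrambleOfOrder G U k₂ →
                       HasScrambleOfOrder G U (k₁ ⊔ k₂)
HasScrambleOfOrder-⊔ {k₁ = k₁} {k₂} scramble₁ scramble₂ with ⊔-sel k₁ k₂
... | inj₁ ⊔≡k₁ rewrite ⊔≡k₁ = scramble₁
... | inj₂ ⊔≡k₂ rewrite ⊔≡k₂ = scramble₂

module _ (G : Graph) (i : Fin (length (edges G))) where

  cutSize≡0⇒sameSide : (A : VSet G) → cutSize (G ─ i) (full (G ─ i)) A ≡ 0 →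
                       All (λ e → A (proj₁ e) ≡ A (proj₂ e)) (removeAt (edges G) i)
  cutSize≡0⇒sameSide A cut≡0 = All.map (λ {e} → xor≡false⇒≡ (A (proj₁ e)) (A (proj₂ e)))
    (count≡0⇒none (crosses (full G) A) (removeAt (edges G) i) cut≡0)

  cutSize-≤-suc-─ : (A : VSet G) → cutSize G (full G) A ≤ suc (cutSize (G ─ i) (full (G ─ i)) A)
  cutSize-≤-suc-─ A = count-≤-suc-removeAt (crosses (full G) A) (edges G) i

  Adj-─ : ∀ {x y} → Adj (G ─ i) x y → Adj G x y
  Adj-─ (inj₁ xy) = inj₁ (∈-removeAt⁻ (edges G) i xy)
  Adj-─ (inj₂ yx) = inj₂ (∈-removeAt⁻ (edges G) i yx)

  Walk-─ : ∀ {S : VSet G} {x y} → Walk (G ─ i) S x y → Walk G S x y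
  Walk-─ (stay Sx) = stay Sx
  Walk-─ (step Sx adj w) = step Sx (Adj-─ adj) (Walk-─ w)

  cutSize-─-∩ : (U A : VSet G) → cutSize (G ─ i) U (U ∩ A) ≤ cutSize G (full G) A
  cutSize-─-∩ U A = ≤-trans
    (count-mono (crosses U (U ∩ A)) (crosses (full G) A) (removeAt (edges G) i)
                (All.tabulate λ {e} _ → drop-U e))
    (count-removeAt-≤ (crosses (full G) A) (edges G) i)
    where
    drop-U : ∀ e → crosses U (U ∩ A) e ≡ true → crosses (full G) A e ≡ true
    drop-U (a , b) cut with U a | U b
    ... | true  | true  = cut

  IsScramble-─ : {U : VSet G} {eggs : List (VSet G)} →
                 IsScramble (G ─ i) U eggs → IsScramble G (full G) eggs
  IsScramble-─ = All.map λ (_ , nonempty , connected) →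
    (λ _ _ → refl) , nonempty , λ x y Ex Ey → Walk-─ (connected x y Ex Ey)

  HasScrambleOfOrder-─ : {U : VSet G} {k : ℕ} →
                         HasScrambleOfOrder (G ─ i) U k → HasScrambleOfOrder G (full G) k
  HasScrambleOfOrder-─ {U} {k} (eggs , scramble , hitting , separating) =
    eggs , IsScramble-─ scramble , hitting′ , separating′
    where
    eggs⊆U : All (λ E → _⊆_ {G} E U) eggs
    eggs⊆U = All.map proj₁ scramble

    hitting′ : (L : List (Fin (n G))) → Hitting G (full G) eggs L → k ≤ length L
    hitting′ L (_ , hits) = ≤-trans
      (hitting (filterᵇ U L)
        ( All.map (Equivalence.to T-≡) (all-filter (T? ∘ U) L)
        , All.zipWith (λ (E⊆U , hit) → filterᵇ-hits U _ E⊆U hit) (eggs⊆U , hits)))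
      (length-filter (T? ∘ U) L)

    separating′ : (A : VSet G) → Separates G (full G) eggs A → k ≤ cutSize G (full G) A
    separating′ A (_ , inside , outside) = ≤-trans
      (separating (U ∩ A) ((λ _ → ∧-conicalˡ _ _) , inside′ , outside′))
      (cutSize-─-∩ U A)
      where
      inside′ : Any (λ E → _⊆_ {G} E (U ∩ A)) eggs
      inside′ = Any.map (λ (E⊆U , E⊆A) v Ev → cong₂ _∧_ (E⊆U v Ev) (E⊆A v Ev))
                        (Any-with-All eggs⊆U inside)

      outside-∩ : ∀ v → U v ≡ true → not (A v) ≡ true → U v ∧ not ((U ∩ A) v) ≡ true
      outside-∩ v Uv ¬Av rewrite Uv = ¬Av

      outside′ : Any (λ E → _⊆_ {G} E (λ v → U v ∧ not ((U ∩ A) v))) eggs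
      outside′ = Any.map (λ (E⊆U , E⊆∁A) v Ev → outside-∩ v (E⊆U v Ev) (E⊆∁A v Ev))
                         (Any-with-All eggs⊆U outside)

singleEgg : (G : Graph) {U E : VSet G} → _⊆_ {G} E U → Nonempty {G} E → Connected G E →
            HasScrambleOfOrder G U 1
singleEgg G {U} {E} E⊆U (x , Ex) connected =
  E ∷ [] , (E⊆U , (x , Ex) , connected) ∷ [] , hitting , separating
  where
  hitting : (L : List (Fin (n G))) → Hitting G U (E ∷ []) L → 1 ≤ length L
  hitting [] (_ , () ∷ [])
  hitting (_ ∷ _) _ = s≤s z≤n

  separating : (A : VSet G) → Separates G U (E ∷ []) A → 1 ≤ cutSize G U A
  separating A (_ , here E⊆A , here E⊆∁A) =
    clash (E⊆A x Ex) (not-injective (∧-conicalʳ _ _ (E⊆∁A x Ex)))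

module Bridge (G : Graph) (i : Fin (length (edges G))) (P : VSet G) (c d : Fin (n G))
  (bridge : lookup (edges G) i ≡ (c , d) ⊎ lookup (edges G) i ≡ (d , c))
  (Pc : P c ≡ true) (Pd : P d ≡ false)
  (noCross : All (λ e → P (proj₁ e) ≡ P (proj₂ e)) (removeAt (edges G) i)) where

  data Step : Fin (n G) → Fin (n G) → Set where
    kept  : ∀ {x y} → Adj (G ─ i) x y → P x ≡ P y → Step x y
    leave : Step c d
    enter : Step d c

  bridgeSteps : ∀ {x y} → (x , y) ≡ (c , d) ⊎ (x , y) ≡ (d , c) → Step x y × Step y x
  bridgeSteps (inj₁ refl) = leave , enter
  bridgeSteps (inj₂ refl) = enter , leave

  bridgeSteps-at : ∀ {x y} → (x , y) ≡ lookup (edges G) i → Step x y × Step y x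
  bridgeSteps-at xy≡ = bridgeSteps (Sum.map (trans xy≡) (trans xy≡) bridge)

  classify : ∀ {x y} → Adj G x y → Step x y
  classify (inj₁ xy) with ∈-removeAt-split (edges G) i xy
  ... | inj₁ xy≡ = proj₁ (bridgeSteps-at xy≡)
  ... | inj₂ xy′ = kept (inj₁ xy′) (All.lookup noCross xy′)
  classify (inj₂ yx) with ∈-removeAt-split (edges G) i yx
  ... | inj₁ yx≡ = proj₂ (bridgeSteps-at yx≡)
  ... | inj₂ yx′ = kept (inj₂ yx′) (sym (All.lookup noCross yx′))

  module _ {E : VSet G} where

    restrictWalk : ∀ {x z} → Walk G E x z → P x ≡ true → P z ≡ true → Walk (G ─ i) (P ∩ E) x z
    reenterWalk  : ∀ {x z} → Walk G E x z → P x ≡ false → P z ≡ true → Walk (G ─ i) (P ∩ E) c z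

    restrictWalk (stay Ex) Px _ = stay (cong₂ _∧_ Px Ex)
    restrictWalk (step Ex adj w) Px Pz with classify adj
    ... | kept adj′ Pxy = step (cong₂ _∧_ Px Ex) adj′ (restrictWalk w (trans (sym Pxy) Px) Pz)
    ... | leave = reenterWalk w Pd Pz
    ... | enter = clash Px Pd

    reenterWalk (stay _) Px Pz = clash Pz Px
    reenterWalk (step _ adj w) Px Pz with classify adj
    ... | kept _ Pxy = reenterWalk w (trans (sym Pxy) Px) Pz
    ... | leave = clash Pc Px
    ... | enter = restrictWalk w Pc Pz

    exitingWalk-visits-c : ∀ {x z} → Walk G E x z → P x ≡ true → P z ≡ false → E c ≡ true
    exitingWalk-visits-c (stay _) Px Pz = clash Px Pz
    exitingWalk-visits-c (step Ex adj w) Px Pz with classify adj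
    ... | kept _ Pxy = exitingWalk-visits-c w (trans (sym Pxy) Px) Pz
    ... | leave = Ex
    ... | enter = clash Px Pd

    Connected-∩ : Connected G E → Connected (G ─ i) (P ∩ E)
    Connected-∩ connected x y PEx PEy =
      restrictWalk (connected x y (∧-conicalʳ _ _ PEx) (∧-conicalʳ _ _ PEy))
                   (∧-conicalˡ _ _ PEx) (∧-conicalˡ _ _ PEy)

  extend : VSet G → VSet G
  extend A x = if P x then A x else A c

  cutSize-extend : (A : VSet G) → cutSize G (full G) (extend A) ≤ cutSize (G ─ i) P A
  cutSize-extend A = ≤-trans
    (count-removeAt-rejected (crosses (full G) (extend A)) (edges G) i bridge-uncut)
    (count-mono (crosses (full G) (extend A)) (crosses P A) (removeAt (edges G) i)
                (All.map kept-cut noCross))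
    where
    uncut : ∀ {e} → e ≡ (c , d) ⊎ e ≡ (d , c) → crosses (full G) (extend A) e ≡ false
    uncut (inj₁ refl) rewrite Pc | Pd = xor-same (A c)
    uncut (inj₂ refl) rewrite Pc | Pd = xor-same (A c)

    bridge-uncut : crosses (full G) (extend A) (lookup (edges G) i) ≡ false
    bridge-uncut = uncut bridge

    kept-cut : ∀ {e} → P (proj₁ e) ≡ P (proj₂ e) →
               crosses (full G) (extend A) e ≡ true → crosses P A e ≡ true
    kept-cut {a , b} Pab cut with P a | P b | Pab
    ... | true  | true  | _ = cut
    ... | false | false | _ = clash cut (xor-same (A c))

  extend-onEgg : {E A : VSet G} {b : Bool} → Connected G E → Meets P E →
                 (∀ v → (P ∩ E) v ≡ true → A v ≡ b) → ∀ w → E w ≡ true → extend A w ≡ b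
  extend-onEgg {E} connected (x , PEx) PE⇒b w Ew with P w in Pw
  ... | true  = PE⇒b w (cong₂ _∧_ Pw Ew)
  ... | false = PE⇒b c (cong₂ _∧_ Pc Ec)
    where
    Ec : E c ≡ true
    Ec = exitingWalk-visits-c (connected x w (∧-conicalʳ _ _ PEx) Ew) (∧-conicalˡ _ _ PEx) Pw

  module _ {eggs : List (VSet G)} (scramble : IsScramble G (full G) eggs)
           (meet : All (Meets P) eggs) where

    private
      connectedMeeting : All (λ E → Connected G E × Meets P E) eggs
      connectedMeeting = All.zipWith (λ ((_ , _ , connected) , meets) → connected , meets)
                                     (scramble , meet)

    IsScramble-∩ : IsScramble (G ─ i) P (map (P ∩_) eggs)
    IsScramble-∩ = map⁺ (All.map
      (λ (connected , meets) → (λ _ → ∧-conicalˡ _ _) , meets , Connected-∩ connected)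
      connectedMeeting)

    Hitting-∩⁻ : {L : List (Fin (n G))} →
                 Hitting (G ─ i) P (map (P ∩_) eggs) L → Hitting G (full G) eggs L
    Hitting-∩⁻ (inP , hits) =
      All.map (λ _ → refl) inP , All.map (Any.map (∧-conicalʳ _ _)) (map⁻ hits)

    Separates-extend : {A : VSet G} → Separates (G ─ i) P (map (P ∩_) eggs) A →
                       Separates G (full G) eggs (extend A)
    Separates-extend {A} (_ , inside , outside) =
      (λ _ _ → refl) ,
      Any.map (λ ((connected , meets) , PE⊆A) → extend-onEgg connected meets PE⊆A)
              (Any-with-All connectedMeeting (Any-map⁻ inside)) ,
      Any.map (λ ((connected , meets) , PE⊆∁A) w →
                 cong not ∘ extend-onEgg connected meets
                               (λ v → not-injective ∘ ∧-conicalʳ _ _ ∘ PE⊆∁A v) w)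
              (Any-with-All connectedMeeting (Any-map⁻ outside))

    HasScrambleOfOrder-∩ : {m : ℕ} → OrderAtLeast G (full G) eggs m →
                           HasScrambleOfOrder (G ─ i) P m
    HasScrambleOfOrder-∩ (hitting , separating) =
      map (P ∩_) eggs , IsScramble-∩ ,
      (λ L hits → hitting L (Hitting-∩⁻ hits)) ,
      (λ A separated →
         ≤-trans (separating (extend A) (Separates-extend separated)) (cutSize-extend A))

order≤cutSize : (G : Graph) {U : VSet G} {eggs : List (VSet G)} {m : ℕ} →
                OrderAtLeast G (full G) eggs m →
                Any (λ E → ¬ Meets (compl {G} U) E) eggs → Any (λ E → ¬ Meets U E) eggs →
                m ≤ cutSize G (full G) U
order≤cutSize G {U} (_ , separating) avoidsOutside avoidsInside = separating U
  ( (λ _ _ → refl)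
  , Any.map (λ {E} avoids w → not-injective ∘ avoids⇒outside (compl {G} U) E avoids w) avoidsOutside
  , Any.map (λ {E} avoids w → cong not ∘ avoids⇒outside U E avoids w) avoidsInside)

lemma2p4 : (G : Graph) → EdgeConnectivity G 1 →
  (i : Fin (length (edges G))) → (u v : Fin (n G)) → lookup (edges G) i ≡ (u , v) →
  (U₁ : VSet G) → U₁ u ≡ true → U₁ v ≡ false →
  Connected (G ─ i) U₁ → Connected (G ─ i) (compl {G ─ i} U₁) →
  cutSize (G ─ i) (full (G ─ i)) U₁ ≡ 0 →
  (k₁ k₂ : ℕ) → ScrambleNumber (G ─ i) U₁ k₁ → ScrambleNumber (G ─ i) (compl {G ─ i} U₁) k₂ →
  ScrambleNumber G (full G) (k₁ ⊔ k₂)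
lemma2p4 G _ i u v edgeᵢ U₁ U₁u U₁v connected₁ _ cut₀ k₁ k₂ sn₁ sn₂ = witness , bounded
  where
  U₂ : VSet G
  U₂ = compl {G} U₁

  noCross : All (λ e → U₁ (proj₁ e) ≡ U₁ (proj₂ e)) (removeAt (edges G) i)
  noCross = cutSize≡0⇒sameSide G i U₁ cut₀

  module Side₁ = Bridge G i U₁ u v (inj₁ edgeᵢ) U₁u U₁v noCross
  module Side₂ = Bridge G i U₂ v u (inj₂ edgeᵢ) (cong not U₁v) (cong not U₁u)
                        (All.map (cong not) noCross)

  witness : HasScrambleOfOrder G (full G) (k₁ ⊔ k₂)
  witness = HasScrambleOfOrder-⊔ (HasScrambleOfOrder-─ G i (proj₁ sn₁))
                                 (HasScrambleOfOrder-─ G i (proj₁ sn₂))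

  1≤k₁ : 1 ≤ k₁
  1≤k₁ = order≤scrambleNumber sn₁ (singleEgg (G ─ i) (λ _ U₁x → U₁x) (u , U₁u) connected₁)

  bridgeCut≤1 : cutSize G (full G) U₁ ≤ 1
  bridgeCut≤1 = subst (λ k → cutSize G (full G) U₁ ≤ suc k) cut₀ (cutSize-≤-suc-─ G i U₁)

  bounded : (eggs : List (VSet G)) (m : ℕ) → IsScramble G (full G) eggs →
            OrderAtLeast G (full G) eggs m → m ≤ k₁ ⊔ k₂
  bounded eggs m scramble order with all? (meets? U₁) eggs | all? (meets? U₂) eggs
  ... | yes meet₁ | _ =
    m≤n⇒m≤n⊔o k₂ (order≤scrambleNumber sn₁ (Side₁.HasScrambleOfOrder-∩ scramble meet₁ order))
  ... | no _ | yes meet₂ =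
    m≤n⇒m≤o⊔n k₁ (order≤scrambleNumber sn₂ (Side₂.HasScrambleOfOrder-∩ scramble meet₂ order))
  ... | no ¬meet₁ | no ¬meet₂ = ≤-trans
    (order≤cutSize G order (¬All⇒Any¬ (meets? U₂) eggs ¬meet₂)
                           (¬All⇒Any¬ (meets? U₁) eggs ¬meet₁))
    (≤-trans bridgeCut≤1 (m≤n⇒m≤n⊔o k₂ 1≤k₁))
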